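{- Let $D=(V,A)$ be a digraph with $\lambda(D)\ge 2$ containing a subdigraph $Q$ that has a good pair. Set $X=N_D^-(Q)$ and $Y=N_D^+(Q)$. If $X\cap Y=\emptyset$ and $X\cup Y=V\setminus V(Q)$, then $D$ has a good pair.
   Context: Digraphs have no loops and no multiple arcs. $\lambda(D)$ is the arc-connectivity (minimum number of arcs leaving a nonempty proper vertex subset). A good pair is an arc-disjoint pair consisting of an out-branching and an in-branching (spanning trees of the underlying graph oriented so that every vertex but the root has in-degree, respectively out-degree, one). $N_D^-(Q)$ ($N_D^+(Q)$) is the set of vertices outside $V(Q)$ having an arc to (from) some vertex of $Q$. -}

module Defs where

open import Data.Nat using (ℕ)
open import Data.Fin using (Fin)
open import Data.Bool using (Bool; true; false)
open import Data.Product using (Σ; ∃; _×_; _,_)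
open import Data.Sum using (_⊎_)
open import Relation.Nullary using (¬_)
open import Relation.Binary.PropositionalEquality using (_≡_)
open import Level using (0ℓ; suc)

-- A digraph on the vertex set Fin n: an arc relation without loops.
-- (Being a relation, there are no multiple arcs.)
record Digraph (n : ℕ) : Set₁ where
  field
    Arc     : Fin n → Fin n → Set
    loopless : ∀ v → ¬ Arc v v
open Digraph public

VSet : ℕ → Set
VSet n = Fin n → Bool

ASet : ℕ → Set₁
ASet n = Fin n → Fin n → Set

ArcConn≥2 : ∀ {n} → Digraph n → Set
ArcConn≥2 {n} D =
  (S : VSet n) → (∃ λ u → S u ≡ true) → (∃ λ u → S u ≡ false) →
  Σ (Fin n) λ a → Σ (Fin n) λ b → Σ (Fin n) λ c → Σ (Fin n) λ d →
    S a ≡ true × S b ≡ false × Arc D a b ×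
    S c ≡ true × S d ≡ false × Arc D c d ×
    ¬ (a ≡ c × b ≡ d)

data Path {n} (T : ASet n) : Fin n → Fin n → Set where
  here  : ∀ {v} → Path T v v
  there : ∀ {u w v} → T u w → Path T w v → Path T u v

Rev : ∀ {n} → ASet n → ASet n
Rev T u v = T v u

-- T is an out-branching rooted at r of the digraph with vertex set S and arc
-- set F: T ⊆ F, every arc of T joins vertices of S, the root has in-degree 0,
-- every other vertex of S has in-degree exactly 1, and every vertex of S is
-- reachable from r along T (so T is a spanning tree of the underlying graph,
-- oriented away from r).
IsOutBranching : ∀ {n} → VSet n → ASet n → ASet n → Fin n → Set
IsOutBranching {n} S F T r =
  (∀ u v → T u v → F u v × S u ≡ true × S v ≡ true) ×
  S r ≡ true ×
  (∀ u → ¬ T u r) ×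
  (∀ v → S v ≡ true → ¬ v ≡ r →
     Σ (Fin n) λ u → T u v × (∀ w → T w v → w ≡ u)) ×
  (∀ v → S v ≡ true → Path T r v)

IsInBranching : ∀ {n} → VSet n → ASet n → ASet n → Fin n → Set
IsInBranching S F T r = IsOutBranching S (Rev F) (Rev T) r

HasGoodPair : ∀ {n} → VSet n → ASet n → Set₁
HasGoodPair {n} S F =
  Σ (ASet n) λ B⁺ → Σ (ASet n) λ B⁻ → Σ (Fin n) λ r⁺ → Σ (Fin n) λ r⁻ →
    IsOutBranching S F B⁺ r⁺ × IsInBranching S F B⁻ r⁻ ×
    (∀ u v → B⁺ u v → ¬ B⁻ u v)

allV : ∀ {n} → VSet n
allV _ = true

IsSubdigraph : ∀ {n} → Digraph n → VSet n → ASet n → Set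
IsSubdigraph D VQ AQ = ∀ u v → AQ u v → Arc D u v × VQ u ≡ true × VQ v ≡ true

InNbr : ∀ {n} → Digraph n → VSet n → Fin n → Set
InNbr D VQ v = VQ v ≡ false × ∃ λ u → VQ u ≡ true × Arc D v u

OutNbr : ∀ {n} → Digraph n → VSet n → Fin n → Set
OutNbr D VQ v = VQ v ≡ false × ∃ λ u → VQ u ≡ true × Arc D u v

{-# OPTIONS --safe #-}
-- Grow the good pair of Q a vertex at a time, keeping an out-branching B⁺ on V⁺ and an in-branching
-- B⁻ on V⁻, both containing V(Q) and arc-disjoint, and only ever attaching leaves. When V⁺ = V⁻, a
-- missing vertex v is a neighbour of Q; if there is an arc q v, then v joins B⁺ by it and becomes a
-- surplus vertex y ∈ V⁺ ∖ V⁻ with at most one arc y f of B⁺ leaving it (an arc v q is the mirror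
-- image, in the reversed digraph). To bring y into V⁻, grow from y a set U of vertices outside V⁻,
-- reached by walks avoiding y f, all of whose vertices after y have an arc from Q. As λ(D) ≥ 2, some
-- arc a t other than y f leaves U. If t ∈ V⁻, the walk to a followed by a t is attached backwards to
-- B⁻, its vertices joining B⁺ through their arcs from Q, and balance is restored. Otherwise t ∉ V⁺:
-- if t has an arc into Q, it joins B⁻ by it before the walk is attached and becomes a mirror-image
-- surplus vertex of V⁻ ∖ V⁺, with a as its only B⁻-predecessor; if not, t has an arc from Q and
-- joins U. Each phase increases |V⁺| + |V⁻|, so both branchings eventually span D.
module Submission where

open import Defs
open import Data.Nat using (ℕ; suc; _+_; _∸_; _≤_; _<_; s≤s⁻¹)
open import Data.Nat.Properties using (<-≤-trans; n<1+n; ∸-monoʳ-<; +-comm; +-mono-≤; +-mono-<-≤; +-mono-≤-<)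
open import Data.Fin using (Fin; _≟_)
open import Data.Fin.Properties using (all?; ¬∀⟶∃¬)
import Data.Fin.Subset as Subset
open import Data.Fin.Subset.Properties using (∣p∣≤n; p⊆q⇒∣p∣≤∣q∣; p⊂q⇒∣p∣<∣q∣)
open import Data.Vec using (tabulate)
open import Data.Vec.Properties using (lookup∘tabulate; lookup⇒[]=; []=⇒lookup)
open import Data.Bool using (true; false; not)
import Data.Bool as Bool
open import Data.Bool.Properties using (not-¬; ¬-not; not-injective)
open import Data.Product using (Σ; ∃; _×_; _,_; proj₁; proj₂; map₂)
import Data.Product as Product
open import Data.Sum using (_⊎_; inj₁; inj₂; swap)
import Data.Sum as Sum
open import Data.Empty using (⊥-elim)
open import Function using (_∘_)
open import Relation.Nullary using (¬_; yes; no; contradiction)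
open import Relation.Binary.PropositionalEquality using (_≡_; refl; sym; trans; cong; subst₂)

private
  variable
    n : ℕ

infix 4 _⊆_ _⊆_∪_

_⊆_ : VSet n → VSet n → Set
S ⊆ T = ∀ v → S v ≡ true → T v ≡ true

_⊆_∪_ : VSet n → VSet n → VSet n → Set
S ⊆ T ∪ T′ = ∀ v → S v ≡ true → T v ≡ true ⊎ T′ v ≡ true

⊆-refl : {S : VSet n} → S ⊆ S
⊆-refl _ Sv = Sv

⊆-∉ : ∀ {S T : VSet n} {v} → S ⊆ T → T v ≡ false → S v ≡ false
⊆-∉ {v = v} S⊆T Tv = ¬-not (λ Sv → not-¬ (S⊆T v Sv) Tv)

insert : VSet n → Fin n → VSet n
insert S v w with w ≟ v
... | yes _ = true
... | no _  = S w

insert-here : ∀ (S : VSet n) v → insert S v v ≡ true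
insert-here S v with v ≟ v
... | yes _  = refl
... | no v≢v = contradiction refl v≢v

insert-⊇ : ∀ (S : VSet n) v → S ⊆ insert S v
insert-⊇ S v w Sw with w ≟ v
... | yes _ = refl
... | no _  = Sw

insert-⊆ : ∀ (S : VSet n) v w → insert S v w ≡ true → w ≡ v ⊎ S w ≡ true
insert-⊆ S v w ins with w ≟ v
... | yes w≡v = inj₁ w≡v
... | no _    = inj₂ ins

insert-mono : ∀ {S T : VSet n} v → S ⊆ T → insert S v ⊆ insert T v
insert-mono {S = S} {T} v S⊆T w ins with insert-⊆ S v w ins
... | inj₁ refl = insert-here T v
... | inj₂ Sw   = insert-⊇ T v w (S⊆T w Sw)

insert-⊆-insert : ∀ {S T : VSet n} b y → S ⊆ insert T y → insert S b ⊆ insert (insert T b) y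
insert-⊆-insert {S = S} {T} b y S⊆T+y v ins with insert-⊆ S b v ins
... | inj₁ refl = insert-⊇ (insert T b) y v (insert-here T b)
... | inj₂ Sv   = insert-mono y (insert-⊇ T b) v (S⊆T+y v Sv)

insert-⊆∪ : ∀ (S T : VSet n) v → T v ≡ true → insert S v ⊆ S ∪ T
insert-⊆∪ S T v Tv w ins with insert-⊆ S v w ins
... | inj₁ refl = inj₂ Tv
... | inj₂ Sw   = inj₁ Sw

size : VSet n → ℕ
size S = Subset.∣ tabulate S ∣

∈-tabulate⁺ : ∀ (S : VSet n) {v} → S v ≡ true → v Subset.∈ tabulate S
∈-tabulate⁺ S {v} Sv = lookup⇒[]= v (tabulate S) (trans (lookup∘tabulate S v) Sv)

∈-tabulate⁻ : ∀ (S : VSet n) {v} → v Subset.∈ tabulate S → S v ≡ true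
∈-tabulate⁻ S {v} v∈S = trans (sym (lookup∘tabulate S v)) ([]=⇒lookup v∈S)

tabulate-⊆ : ∀ {S T : VSet n} → S ⊆ T → tabulate S Subset.⊆ tabulate T
tabulate-⊆ {S = S} {T} S⊆T {v} = ∈-tabulate⁺ T ∘ S⊆T v ∘ ∈-tabulate⁻ S

size≤n : (S : VSet n) → size S ≤ n
size≤n S = ∣p∣≤n (tabulate S)

size-mono : ∀ {S T : VSet n} → S ⊆ T → size S ≤ size T
size-mono S⊆T = p⊆q⇒∣p∣≤∣q∣ (tabulate-⊆ S⊆T)

size-mono-< : ∀ {S T : VSet n} → S ⊆ T → ∀ v → S v ≡ false → T v ≡ true → size S < size T
size-mono-< {S = S} {T} S⊆T v Sv Tv =
  p⊂q⇒∣p∣<∣q∣ (tabulate-⊆ S⊆T , v , ∈-tabulate⁺ T Tv , λ v∈S → not-¬ (∈-tabulate⁻ S v∈S) Sv)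

full-or-missing : (S : VSet n) → (∀ v → S v ≡ true) ⊎ ∃ λ v → S v ≡ false
full-or-missing S with all? (λ v → S v Bool.≟ true)
... | yes full = inj₁ full
... | no ¬full = inj₂ (map₂ ¬-not (¬∀⟶∃¬ _ _ (λ v → S v Bool.≟ true) ¬full))

module _ {a r} {A : Set a} {R : Set r} (μ : A → ℕ) {bound : ℕ} (μ≤bound : ∀ x → μ x ≤ bound) where

  ascend : (∀ x → R ⊎ Σ A λ y → μ x < μ y) → A → R
  ascend step x = go (suc (bound ∸ μ x)) x (n<1+n _)
    where
    go : ∀ k x → bound ∸ μ x < k → R
    go (suc k) x gap with step x
    ... | inj₁ done       = done
    ... | inj₂ (y , μx<μy) = go k y (<-≤-trans (∸-monoʳ-< μx<μy (μ≤bound y)) (s≤s⁻¹ gap))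

-- Branchings

Path-map : ∀ {T T′ : ASet n} → (∀ {u v} → T u v → T′ u v) → ∀ {x y} → Path T x y → Path T′ x y
Path-map f here        = here
Path-map f (there t p) = there (f t) (Path-map f p)

Path-snoc : ∀ {T : ASet n} {x y z} → Path T x y → T y z → Path T x z
Path-snoc here         t = there t here
Path-snoc (there t′ p) t = there t′ (Path-snoc p t)

addArc : ASet n → Fin n → Fin n → ASet n
addArc T u v a b = T a b ⊎ (a ≡ u × b ≡ v)

IsOutBranching-addLeaf : ∀ {S : VSet n} {F T : ASet n} {r u v} → IsOutBranching S F T r →
  S u ≡ true → S v ≡ false → F u v → IsOutBranching (insert S v) F (addArc T u v) r
IsOutBranching-addLeaf {n} {S} {F} {T} {r} {u} {v} (inside , Sr , root , parent , reach) Su Sv Fuv =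
  inside′ , insert-⊇ S v r Sr , root′ , parent′ , reach′
  where
  T′ : ASet n
  T′ = addArc T u v
  inside′ : ∀ a b → T′ a b → F a b × insert S v a ≡ true × insert S v b ≡ true
  inside′ a b (inj₁ t) with inside a b t
  ... | Fab , Sa , Sb = Fab , insert-⊇ S v a Sa , insert-⊇ S v b Sb
  inside′ a b (inj₂ (refl , refl)) = Fuv , insert-⊇ S v u Su , insert-here S v
  root′ : ∀ a → ¬ T′ a r
  root′ a (inj₁ t)          = root a t
  root′ a (inj₂ (_ , refl)) = not-¬ Sr Sv
  parent′ : ∀ w → insert S v w ≡ true → ¬ w ≡ r → Σ (Fin n) λ p → T′ p w × (∀ z → T′ z w → z ≡ p)
  parent′ w Sw w≢r with w ≟ v
  ... | yes refl = u , inj₂ (refl , refl) , unique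
    where
    unique : ∀ z → T′ z w → z ≡ u
    unique z (inj₁ t)      = contradiction (proj₂ (proj₂ (inside z w t))) (not-¬ Sv)
    unique z (inj₂ (z≡u , _)) = z≡u
  ... | no w≢v with parent w Sw w≢r
  ...   | p , Tpw , unique-p = p , inj₁ Tpw , unique
    where
    unique : ∀ z → T′ z w → z ≡ p
    unique z (inj₁ t)          = unique-p z t
    unique z (inj₂ (_ , w≡v)) = contradiction w≡v w≢v
  reach′ : ∀ w → insert S v w ≡ true → Path T′ r w
  reach′ w Sw with insert-⊆ S v w Sw
  ... | inj₁ refl = Path-snoc (Path-map inj₁ (reach u Su)) (inj₂ (refl , refl))
  ... | inj₂ Sw′  = Path-map inj₁ (reach w Sw′)

IsOutBranching-weaken : ∀ {S : VSet n} {F G T : ASet n} {r} → (∀ {u v} → F u v → G u v) →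
  IsOutBranching S F T r → IsOutBranching S G T r
IsOutBranching-weaken F⊆G (inside , rest) =
  (λ u v t → let (Fuv , Su , Sv) = inside u v t in F⊆G Fuv , Su , Sv) , rest

IsOutBranching-spanning : ∀ {S : VSet n} {F T : ASet n} {r} → (∀ v → S v ≡ true) →
  IsOutBranching S F T r → IsOutBranching allV F T r
IsOutBranching-spanning full (inside , _ , root , parent , reach) =
  (λ u v t → proj₁ (inside u v t) , refl , refl) , refl , root ,
  (λ v _ → parent v (full v)) , (λ v _ → reach v (full v))

reverse : Digraph n → Digraph n
reverse D = record { Arc = Rev (Arc D) ; loopless = loopless D }

ArcConn≥2-reverse : {D : Digraph n} → ArcConn≥2 D → ArcConn≥2 (reverse D)
ArcConn≥2-reverse conn S (u , Su) (w , Sw)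
  with conn (λ x → not (S x)) (w , cong not Sw) (u , cong not Su)
... | a , b , c , d , Sa , Sb , Dab , Sc , Sd , Dcd , distinct =
  b , a , d , c , not-injective Sb , not-injective Sa , Dab , not-injective Sd , not-injective Sc , Dcd ,
  λ { (b≡d , a≡c) → distinct (a≡c , b≡d) }

LeavingArc : Digraph n → VSet n → Fin n → Fin n → Set
LeavingArc {n} D S y f =
  Σ (Fin n) λ a → Σ (Fin n) λ t → S a ≡ true × S t ≡ false × Arc D a t × ¬ (a ≡ y × t ≡ f)

leaving-arc-avoiding : {D : Digraph n} → ArcConn≥2 D → (S : VSet n) →
  ∃ (λ u → S u ≡ true) → ∃ (λ u → S u ≡ false) → (y f : Fin n) → LeavingArc D S y f
leaving-arc-avoiding conn S inside outside y f with conn S inside outside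
... | a , b , c , d , Sa , Sb , Dab , Sc , Sd , Dcd , distinct with a ≟ y | b ≟ f
...   | yes refl | yes refl = c , d , Sc , Sd , Dcd , λ { (refl , refl) → distinct (refl , refl) }
...   | yes _    | no b≢f   = a , b , Sa , Sb , Dab , b≢f ∘ proj₂
...   | no a≢y   | _        = a , b , Sa , Sb , Dab , a≢y ∘ proj₁

NbrCovered : Digraph n → VSet n → Set
NbrCovered D Q = ∀ v → Q v ≡ false → InNbr D Q v ⊎ OutNbr D Q v

NbrCovered-reverse : {D : Digraph n} {Q : VSet n} → NbrCovered D Q → NbrCovered (reverse D) Q
NbrCovered-reverse cover v Qv = swap (cover v Qv)

-- Partial good pairs

record PartialGoodPair (D : Digraph n) (Q : VSet n) : Set₁ where
  field
    V⁺ V⁻ : VSet n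
    B⁺ B⁻ : ASet n
    r⁺ r⁻ : Fin n
    out-branching : IsOutBranching V⁺ (Arc D) B⁺ r⁺
    in-branching  : IsInBranching V⁻ (Arc D) B⁻ r⁻
    arc-disjoint  : ∀ u v → B⁺ u v → ¬ B⁻ u v
    Q⊆V⁺ : Q ⊆ V⁺
    Q⊆V⁻ : Q ⊆ V⁻

  B⁺-inside : ∀ u v → B⁺ u v → V⁺ u ≡ true × V⁺ v ≡ true
  B⁺-inside u v b = proj₂ (proj₁ out-branching u v b)

  B⁻-inside : ∀ u v → B⁻ u v → V⁻ u ≡ true × V⁻ v ≡ true
  B⁻-inside u v b = let (_ , Sv , Su) = proj₁ in-branching v u b in Su , Sv

  r⁻∈V⁻ : V⁻ r⁻ ≡ true
  r⁻∈V⁻ = proj₁ (proj₂ in-branching)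

  measure : ℕ
  measure = size V⁺ + size V⁻

open PartialGoodPair

private
  variable
    D : Digraph n
    Q : VSet n

reversePair : PartialGoodPair D Q → PartialGoodPair (reverse D) Q
reversePair p = record
  { V⁺ = V⁻ p ; V⁻ = V⁺ p ; B⁺ = Rev (B⁻ p) ; B⁻ = Rev (B⁺ p) ; r⁺ = r⁻ p ; r⁻ = r⁺ p
  ; out-branching = in-branching p ; in-branching = out-branching p
  ; arc-disjoint = λ u v b⁻ b⁺ → arc-disjoint p v u b⁺ b⁻
  ; Q⊆V⁺ = Q⊆V⁻ p ; Q⊆V⁻ = Q⊆V⁺ p }

reversePair-< : (p : PartialGoodPair D Q) (p′ : PartialGoodPair (reverse D) Q) →
  measure (reversePair p) < measure p′ → measure p < measure (reversePair p′)
reversePair-< p p′ = subst₂ _<_ (+-comm (size (V⁻ p)) (size (V⁺ p))) (+-comm (size (V⁺ p′)) (size (V⁻ p′)))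

measure≤ : ∀ {n} {D : Digraph n} {Q} (p : PartialGoodPair D Q) → measure p ≤ n + n
measure≤ p = +-mono-≤ (size≤n (V⁺ p)) (size≤n (V⁻ p))

HasGoodPair⇒PartialGoodPair : ∀ {VQ AQ} → IsSubdigraph D VQ AQ → HasGoodPair VQ AQ →
  PartialGoodPair D VQ
HasGoodPair⇒PartialGoodPair {VQ = VQ} sub (B⁺ , B⁻ , r⁺ , r⁻ , out , in′ , disjoint) = record
  { V⁺ = VQ ; V⁻ = VQ ; B⁺ = B⁺ ; B⁻ = B⁻ ; r⁺ = r⁺ ; r⁻ = r⁻
  ; out-branching = IsOutBranching-weaken (λ {u} {v} a → proj₁ (sub u v a)) out
  ; in-branching = IsOutBranching-weaken (λ {u} {v} a → proj₁ (sub v u a)) in′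
  ; arc-disjoint = disjoint
  ; Q⊆V⁺ = ⊆-refl ; Q⊆V⁻ = ⊆-refl }

attach⁺ : (p : PartialGoodPair D Q) (u v : Fin n) → V⁺ p u ≡ true → V⁺ p v ≡ false →
  Arc D u v → ¬ B⁻ p u v → PartialGoodPair D Q
attach⁺ p u v Su Sv Duv ¬B⁻ = record p
  { V⁺ = insert (V⁺ p) v
  ; B⁺ = addArc (B⁺ p) u v
  ; out-branching = IsOutBranching-addLeaf (out-branching p) Su Sv Duv
  ; arc-disjoint = disjoint
  ; Q⊆V⁺ = λ x Qx → insert-⊇ (V⁺ p) v x (Q⊆V⁺ p x Qx) }
  where
  disjoint : ∀ a b → addArc (B⁺ p) u v a b → ¬ B⁻ p a b
  disjoint a b (inj₁ b⁺)           = arc-disjoint p a b b⁺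
  disjoint a b (inj₂ (refl , refl)) = ¬B⁻

attach⁻ : (p : PartialGoodPair D Q) (v w : Fin n) → V⁻ p w ≡ true → V⁻ p v ≡ false →
  Arc D v w → ¬ B⁺ p v w → PartialGoodPair D Q
attach⁻ p v w Sw Sv Dvw ¬B⁺ = reversePair (attach⁺ (reversePair p) w v Sw Sv Dvw ¬B⁺)

spanning⇒HasGoodPair : (p : PartialGoodPair D Q) → (∀ v → V⁺ p v ≡ true) → (∀ v → V⁻ p v ≡ true) →
  HasGoodPair allV (Arc D)
spanning⇒HasGoodPair p full⁺ full⁻ =
  B⁺ p , B⁻ p , r⁺ p , r⁻ p ,
  IsOutBranching-spanning full⁺ (out-branching p) , IsOutBranching-spanning full⁻ (in-branching p) ,
  arc-disjoint p

Balanced : PartialGoodPair D Q → Set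
Balanced p = V⁺ p ⊆ V⁻ p × V⁻ p ⊆ V⁺ p

-- f is the only out-neighbour of y in B⁺, so B⁻ may reach y by any arc except y f.
record Surplus {n} {D : Digraph n} {Q : VSet n} (p : PartialGoodPair D Q) (y f : Fin n) : Set where
  field
    V⁻⊆V⁺      : V⁻ p ⊆ V⁺ p
    V⁺⊆V⁻+y    : V⁺ p ⊆ insert (V⁻ p) y
    y∈V⁺       : V⁺ p y ≡ true
    y∉V⁻       : V⁻ p y ≡ false
    B⁺-from-y  : ∀ w → B⁺ p y w → w ≡ f

data Phase {n} {D : Digraph n} {Q : VSet n} (p : PartialGoodPair D Q) : Set where
  balanced : Balanced p → Phase p
  surplus⁺ : ∀ {y f} → Surplus p y f → Phase p
  surplus⁻ : ∀ {x g} → Surplus (reversePair p) x g → Phase p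

Stage : Digraph n → VSet n → Set₁
Stage D Q = Σ (PartialGoodPair D Q) Phase

Advance : PartialGoodPair D Q → Set₁
Advance {D = D} {Q} p = Σ (Stage D Q) λ s → measure p < measure (proj₁ s)

Phase-reverse : {p : PartialGoodPair (reverse D) Q} → Phase p → Phase (reversePair p)
Phase-reverse (balanced (V⁺⊆V⁻ , V⁻⊆V⁺)) = balanced (V⁻⊆V⁺ , V⁺⊆V⁻)
Phase-reverse (surplus⁺ s) = surplus⁻ s
Phase-reverse (surplus⁻ s) = surplus⁺ s

Advance-reverse : (p : PartialGoodPair D Q) → Advance (reversePair p) → Advance p
Advance-reverse p ((p′ , φ) , lt) = (reversePair p′ , Phase-reverse φ) , reversePair-< p p′ lt

-- Resolving a surplus vertex

module Augmentation {n} (D : Digraph n) (conn : ArcConn≥2 D) (Q : VSet n) (cover : NbrCovered D Q) where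

  private
    Pair = PartialGoodPair D Q

  measure-<⁺ : ∀ {p p′ : Pair} v → V⁺ p ⊆ V⁺ p′ → V⁻ p ⊆ V⁻ p′ →
    V⁺ p v ≡ false → V⁺ p′ v ≡ true → measure p < measure p′
  measure-<⁺ v V⁺⊆ V⁻⊆ Vv V′v = +-mono-<-≤ (size-mono-< V⁺⊆ v Vv V′v) (size-mono V⁻⊆)

  measure-<⁻ : ∀ {p p′ : Pair} v → V⁺ p ⊆ V⁺ p′ → V⁻ p ⊆ V⁻ p′ →
    V⁻ p v ≡ false → V⁻ p′ v ≡ true → measure p < measure p′
  measure-<⁻ v V⁺⊆ V⁻⊆ Vv V′v = +-mono-≤-< (size-mono V⁺⊆) (size-mono-< V⁻⊆ v Vv V′v)

  -- The part of a surplus that survives while its walk is being committed.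
  record Excess (p : Pair) (y f : Fin n) : Set where
    field
      V⁺⊆V⁻+y   : V⁺ p ⊆ insert (V⁻ p) y
      y∈V⁺      : V⁺ p y ≡ true
      y∉Q       : Q y ≡ false
      B⁺-from-y : ∀ w → B⁺ p y w → w ≡ f

    only-y : ∀ {v} → V⁺ p v ≡ true → V⁻ p v ≡ false → v ≡ y
    only-y {v} V⁺v V⁻v with insert-⊆ (V⁻ p) y v (V⁺⊆V⁻+y v V⁺v)
    ... | inj₁ v≡y  = v≡y
    ... | inj₂ V⁻v′ = ⊥-elim (not-¬ V⁻v′ V⁻v)

    V⁺⊆V⁻-if-y∈V⁻ : V⁻ p y ≡ true → V⁺ p ⊆ V⁻ p
    V⁺⊆V⁻-if-y∈V⁻ Vy v V⁺v with insert-⊆ (V⁻ p) y v (V⁺⊆V⁻+y v V⁺v)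
    ... | inj₁ refl = Vy
    ... | inj₂ V⁻v  = V⁻v

  open Excess

  Surplus⇒Excess : ∀ {p y f} → Surplus p y f → Excess p y f
  Surplus⇒Excess {p} s = record
    { V⁺⊆V⁻+y = S.V⁺⊆V⁻+y ; y∈V⁺ = S.y∈V⁺ ; B⁺-from-y = S.B⁺-from-y ; y∉Q = ⊆-∉ (Q⊆V⁻ p) S.y∉V⁻ }
    where module S = Surplus s

  Excess-attach⁻ : ∀ {p y f v w} Sw Sv Dvw ¬B⁺ → Excess p y f → Excess (attach⁻ p v w Sw Sv Dvw ¬B⁺) y f
  Excess-attach⁻ {p} {y} {v = v} _ _ _ _ exc = record
    { V⁺⊆V⁻+y = λ u → insert-mono y (insert-⊇ (V⁻ p) v) u ∘ V⁺⊆V⁻+y exc u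
    ; y∈V⁺ = y∈V⁺ exc ; y∉Q = y∉Q exc ; B⁺-from-y = B⁺-from-y exc }

  record Extends (p p′ : Pair) (U : VSet n) : Set where
    field
      V⁺-grows : V⁺ p ⊆ V⁺ p′
      V⁻-grows : V⁻ p ⊆ V⁻ p′
      V⁺-new   : V⁺ p′ ⊆ V⁺ p ∪ U
      V⁻-new   : V⁻ p′ ⊆ V⁻ p ∪ V⁺ p′

  open Extends

  Extends-refl : ∀ {p U} → Extends p p U
  Extends-refl = record
    { V⁺-grows = ⊆-refl ; V⁻-grows = ⊆-refl ; V⁺-new = λ _ → inj₁ ; V⁻-new = λ _ → inj₁ }

  Extends-trans : ∀ {p p₁ p₂ U} → Extends p p₁ U → Extends p₁ p₂ U → Extends p p₂ U
  Extends-trans {p} {p₁} {p₂} {U} e₁ e₂ = record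
    { V⁺-grows = λ v → V⁺-grows e₂ v ∘ V⁺-grows e₁ v
    ; V⁻-grows = λ v → V⁻-grows e₂ v ∘ V⁻-grows e₁ v
    ; V⁺-new   = V⁺-new′
    ; V⁻-new   = V⁻-new′ }
    where
    V⁺-new′ : V⁺ p₂ ⊆ V⁺ p ∪ U
    V⁺-new′ v V⁺₂v with V⁺-new e₂ v V⁺₂v
    ... | inj₂ Uv   = inj₂ Uv
    ... | inj₁ V⁺₁v = V⁺-new e₁ v V⁺₁v
    V⁻-new′ : V⁻ p₂ ⊆ V⁻ p ∪ V⁺ p₂
    V⁻-new′ v V⁻₂v with V⁻-new e₂ v V⁻₂v
    ... | inj₂ V⁺₂v = inj₂ V⁺₂v
    ... | inj₁ V⁻₁v with V⁻-new e₁ v V⁻₁v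
    ...   | inj₁ V⁻v  = inj₁ V⁻v
    ...   | inj₂ V⁺₁v = inj₂ (V⁺-grows e₂ v V⁺₁v)

  -- Read backwards, the walk attaches its vertices to B⁻; each vertex after y can join B⁺ through
  -- its arc from Q.
  data Walk (U : VSet n) (y f : Fin n) : Fin n → Set where
    start : Walk U y f y
    step  : ∀ {a b} → Walk U y f a → Arc D a b → ¬ (a ≡ y × b ≡ f) → U b ≡ true → OutNbr D Q b →
            Walk U y f b

  Walk-mono : ∀ {U U′ y f a} → U ⊆ U′ → Walk U y f a → Walk U′ y f a
  Walk-mono U⊆U′ start                 = start
  Walk-mono U⊆U′ (step w Dab ne Ub nbr) = step (Walk-mono U⊆U′ w) Dab ne (U⊆U′ _ Ub) nbr

  record Entered (p p₁ : Pair) (U : VSet n) (y f b t : Fin n) : Set where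
    field
      excess  : Excess p₁ y f
      extends : Extends p p₁ U
      b∈V⁻    : V⁻ p₁ b ≡ true
      B⁻-new  : ∀ u v → B⁻ p₁ u v → B⁻ p u v ⊎ (u ≡ b × v ≡ t)

  open Entered

  enter-surplus : ∀ {U y f b t} (p : Pair) → Excess p y f → V⁻ p t ≡ true → Arc D b t →
    ¬ (b ≡ y × t ≡ f) → V⁻ p b ≡ false → V⁺ p b ≡ true → Σ Pair λ p₁ → Entered p p₁ U y f b t
  enter-surplus {U} {y} {f} {b} {t} p exc Vt Dbt bt≢yf V⁻b V⁺b = p₁ , record
    { excess = Excess-attach⁻ Vt V⁻b Dbt ¬B⁺ exc
    ; extends = record
      { V⁺-grows = ⊆-refl ; V⁻-grows = insert-⊇ (V⁻ p) b
      ; V⁺-new = λ _ → inj₁ ; V⁻-new = insert-⊆∪ (V⁻ p) (V⁺ p) b V⁺b }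
    ; b∈V⁻ = insert-here (V⁻ p) b
    ; B⁻-new = λ _ _ → Sum.map₂ Product.swap }
    where
    ¬B⁺ : ¬ B⁺ p b t
    ¬B⁺ B⁺bt with only-y exc V⁺b V⁻b
    ... | refl = bt≢yf (refl , B⁺-from-y exc t B⁺bt)
    p₁ : Pair
    p₁ = attach⁻ p b t Vt V⁻b Dbt ¬B⁺

  enter-fresh : ∀ {U y f b t} (p : Pair) → Excess p y f → V⁻ p t ≡ true → Arc D b t →
    V⁻ p b ≡ false → V⁺ p b ≡ false → U b ≡ true → OutNbr D Q b → Σ Pair λ p₂ → Entered p p₂ U y f b t
  enter-fresh {U} {y} {f} {b} {t} p exc Vt Dbt V⁻b V⁺b Ub (_ , q , Qq , Dqb) = p₂ , record
    { excess = record
      { V⁺⊆V⁻+y = insert-⊆-insert b y (V⁺⊆V⁻+y exc)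
      ; y∈V⁺ = insert-⊇ (V⁺ p) b y (y∈V⁺ exc)
      ; y∉Q = y∉Q exc
      ; B⁺-from-y = B⁺-from-y′ }
    ; extends = record
      { V⁺-grows = insert-⊇ (V⁺ p) b ; V⁻-grows = insert-⊇ (V⁻ p) b
      ; V⁺-new = insert-⊆∪ (V⁺ p) U b Ub
      ; V⁻-new = insert-⊆∪ (V⁻ p) (insert (V⁺ p) b) b (insert-here (V⁺ p) b) }
    ; b∈V⁻ = insert-here (V⁻ p) b
    ; B⁻-new = λ _ _ → Sum.map₂ Product.swap }
    where
    ¬B⁻ : ¬ B⁻ p q b
    ¬B⁻ B⁻qb = not-¬ (proj₂ (B⁻-inside p q b B⁻qb)) V⁻b
    p₁ : Pair
    p₁ = attach⁺ p q b (Q⊆V⁺ p q Qq) V⁺b Dqb ¬B⁻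
    ¬B⁺ : ¬ B⁺ p₁ b t
    ¬B⁺ (inj₁ B⁺bt)      = not-¬ (proj₁ (B⁺-inside p b t B⁺bt)) V⁺b
    ¬B⁺ (inj₂ (refl , _)) = not-¬ (Q⊆V⁺ p b Qq) V⁺b
    p₂ : Pair
    p₂ = attach⁻ p₁ b t Vt V⁻b Dbt ¬B⁺
    B⁺-from-y′ : ∀ w → B⁺ p₂ y w → w ≡ f
    B⁺-from-y′ w (inj₁ B⁺yw)      = B⁺-from-y exc w B⁺yw
    B⁺-from-y′ w (inj₂ (refl , _)) = ⊥-elim (not-¬ Qq (y∉Q exc))

  enter : ∀ {U y f b t} (p : Pair) → Excess p y f → V⁻ p t ≡ true → Arc D b t → ¬ (b ≡ y × t ≡ f) →
    (V⁺ p b ≡ false → U b ≡ true × OutNbr D Q b) → Σ Pair λ p₁ → Entered p p₁ U y f b t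
  enter {b = b} p exc Vt Dbt bt≢yf fresh with V⁻ p b in V⁻b
  ... | true = p , record { excess = exc ; extends = Extends-refl ; b∈V⁻ = V⁻b ; B⁻-new = λ _ _ → inj₁ }
  ... | false with V⁺ p b in V⁺b
  ...   | true  = enter-surplus p exc Vt Dbt bt≢yf V⁻b V⁺b
  ...   | false = let (Ub , nbr) = fresh refl in enter-fresh p exc Vt Dbt V⁻b V⁺b Ub nbr

  record Committed (p p′ : Pair) (U : VSet n) (t a : Fin n) : Set where
    field
      extends : Extends p p′ U
      V⁺⊆V⁻   : V⁺ p′ ⊆ V⁻ p′
      B⁻-new  : ∀ u v → B⁻ p′ u v → B⁻ p u v ⊎ (u ≡ a × v ≡ t) ⊎ U v ≡ true

  open Committed

  enter-then-commit : ∀ {p p₁ p′ U y f b t a} → Entered p p₁ U y f b t → U b ≡ true → Committed p₁ p′ U b a →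
    Committed p p′ U t b
  enter-then-commit {p} {p₁} {p′} {U} {b = b} {t} e Ub c = record
    { extends = Extends-trans (extends e) (extends c) ; V⁺⊆V⁻ = V⁺⊆V⁻ c ; B⁻-new = B⁻-new′ }
    where
    B⁻-new′ : ∀ u v → B⁻ p′ u v → B⁻ p u v ⊎ (u ≡ b × v ≡ t) ⊎ U v ≡ true
    B⁻-new′ u v B⁻′ with B⁻-new c u v B⁻′
    ... | inj₁ B⁻₁                = Sum.map₂ inj₁ (B⁻-new e u v B⁻₁)
    ... | inj₂ (inj₁ (_ , refl)) = inj₂ (inj₂ Ub)
    ... | inj₂ (inj₂ Uv)         = inj₂ (inj₂ Uv)

  commit-walk : ∀ {U y f a} (p : Pair) → Excess p y f → Walk U y f a → ∀ t →
    V⁻ p t ≡ true → Arc D a t → ¬ (a ≡ y × t ≡ f) → Σ Pair λ p′ → Committed p p′ U t a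
  commit-walk p exc start t Vt Dyt yt≢yf with enter p exc Vt Dyt yt≢yf (⊥-elim ∘ not-¬ (y∈V⁺ exc))
  ... | p₁ , e = p₁ , record
        { extends = extends e
        ; V⁺⊆V⁻ = V⁺⊆V⁻-if-y∈V⁻ (excess e) (b∈V⁻ e)
        ; B⁻-new = λ u v → Sum.map₂ inj₁ ∘ B⁻-new e u v }
  commit-walk p exc (step walk Dab ab≢yf Ub nbr) t Vt Dbt bt≢yf
    with enter p exc Vt Dbt bt≢yf (λ _ → Ub , nbr)
  ... | p₁ , e with commit-walk p₁ (excess e) walk _ (b∈V⁻ e) Dab ab≢yf
  ...   | p′ , c = p′ , enter-then-commit e Ub c

  record Region (p : Pair) (y f : Fin n) : Set where
    field
      U       : VSet n
      y∈U     : U y ≡ true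
      U∩V⁻=∅ : ∀ u → U u ≡ true → V⁻ p u ≡ false
      walk    : ∀ u → U u ≡ true → Walk U y f u

  record Exit (p : Pair) (y f : Fin n) : Set where
    field
      U     : VSet n
      a t   : Fin n
      walk  : Walk U y f a
      t∉U   : U t ≡ false
      arc   : Arc D a t
      at≢yf : ¬ (a ≡ y × t ≡ f)
      lands : V⁻ p t ≡ true ⊎ (V⁻ p t ≡ false × V⁺ p t ≡ false × InNbr D Q t)

  Region-extend : ∀ {p y f a t} (R : Region p y f) → let open Region R in
    U a ≡ true → U t ≡ false → Arc D a t → ¬ (a ≡ y × t ≡ f) → V⁻ p t ≡ false → OutNbr D Q t →
    Σ (Region p y f) λ R′ → size U < size (Region.U R′)
  Region-extend {p} {y} {f} {a} {t} R Ua Ut Dat at≢yf V⁻t nbr⁺ =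
    R′ , size-mono-< (insert-⊇ U t) t Ut (insert-here U t)
    where
    open Region R
    U∩V⁻=∅′ : ∀ u → insert U t u ≡ true → V⁻ p u ≡ false
    U∩V⁻=∅′ u Uu with insert-⊆ U t u Uu
    ... | inj₁ refl = V⁻t
    ... | inj₂ Uu′  = U∩V⁻=∅ u Uu′
    walk′ : ∀ u → insert U t u ≡ true → Walk (insert U t) y f u
    walk′ u Uu with insert-⊆ U t u Uu
    ... | inj₁ refl = step (Walk-mono (insert-⊇ U t) (walk a Ua)) Dat at≢yf (insert-here U t) nbr⁺
    ... | inj₂ Uu′  = Walk-mono (insert-⊇ U t) (walk u Uu′)
    R′ : Region p y f
    R′ = record { U = insert U t ; y∈U = insert-⊇ U t y y∈U ; U∩V⁻=∅ = U∩V⁻=∅′ ; walk = walk′ }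

  grow-or-exit : ∀ {p y f} → Surplus p y f → (R : Region p y f) →
    Exit p y f ⊎ Σ (Region p y f) λ R′ → size (Region.U R) < size (Region.U R′)
  grow-or-exit {p} {y} {f} s R = classify (leaving-arc-avoiding {D = D} conn U (y , y∈U) (r⁻ p , r⁻∉U) y f)
    where
    open Region R
    r⁻∉U : U (r⁻ p) ≡ false
    r⁻∉U = ¬-not (λ Ur⁻ → not-¬ (r⁻∈V⁻ p) (U∩V⁻=∅ _ Ur⁻))
    classify : LeavingArc D U y f → Exit p y f ⊎ Σ (Region p y f) λ R′ → size U < size (Region.U R′)
    classify (a , t , Ua , Ut , Dat , at≢yf) with V⁻ p t in V⁻t
    ... | true = inj₁ (record
          { U = U ; walk = walk a Ua ; t∉U = Ut ; arc = Dat ; at≢yf = at≢yf ; lands = inj₁ V⁻t })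
    ... | false with V⁺ p t in V⁺t
    ...   | true with only-y (Surplus⇒Excess s) V⁺t V⁻t
    ...     | refl = ⊥-elim (not-¬ y∈U Ut)
    classify (a , t , Ua , Ut , Dat , at≢yf) | false | false with cover t (⊆-∉ (Q⊆V⁻ p) V⁻t)
    ... | inj₁ nbr⁻ = inj₁ (record
          { U = U ; walk = walk a Ua ; t∉U = Ut ; arc = Dat ; at≢yf = at≢yf ; lands = inj₂ (V⁻t , V⁺t , nbr⁻) })
    ... | inj₂ nbr⁺ = inj₂ (Region-extend R Ua Ut Dat at≢yf V⁻t nbr⁺)

  find-exit : ∀ {p y f} → Surplus p y f → Exit p y f
  find-exit {p} {y} {f} s = ascend (size ∘ Region.U) (size≤n ∘ Region.U) (grow-or-exit s) R₀
    where
    U₀ : VSet n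
    U₀ = insert (λ _ → false) y
    R₀ : Region p y f
    R₀ = record
      { U = U₀
      ; y∈U = insert-here (λ _ → false) y
      ; U∩V⁻=∅ = λ u U₀u → Sum.[ (λ { refl → Surplus.y∉V⁻ s }) , (λ ()) ] (insert-⊆ (λ _ → false) y u U₀u)
      ; walk = λ u U₀u → Sum.[ (λ { refl → start }) , (λ ()) ] (insert-⊆ (λ _ → false) y u U₀u) }

  rebalance : ∀ {p y f U a t} → Surplus p y f → Walk U y f a →
    V⁻ p t ≡ true → Arc D a t → ¬ (a ≡ y × t ≡ f) → Advance p
  rebalance {p} {y} {f} {U} {a} {t} s walk V⁻t Dat at≢yf
    with commit-walk p (Surplus⇒Excess s) walk t V⁻t Dat at≢yf
  ... | p′ , c = (p′ , balanced (V⁺⊆V⁻ c , V⁻⊆V⁺′)) ,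
                 measure-<⁻ {p} {p′} y (V⁺-grows e) (V⁻-grows e) S.y∉V⁻ (V⁺⊆V⁻ c y (V⁺-grows e y S.y∈V⁺))
    where
    module S = Surplus s
    e : Extends p p′ U
    e = extends c
    V⁻⊆V⁺′ : V⁻ p′ ⊆ V⁺ p′
    V⁻⊆V⁺′ v V⁻′v with V⁻-new e v V⁻′v
    ... | inj₁ V⁻v = V⁺-grows e v (S.V⁻⊆V⁺ v V⁻v)
    ... | inj₂ V⁺v = V⁺v

  transfer-surplus : ∀ {p y f U a t} → Surplus p y f → Walk U y f a → U t ≡ false →
    V⁻ p t ≡ false → V⁺ p t ≡ false → InNbr D Q t → Arc D a t → ¬ (a ≡ y × t ≡ f) → Advance p
  transfer-surplus {p} {y} {f} {U} {a} {t} s walk t∉U V⁻t V⁺t (_ , q , Qq , Dtq) Dat at≢yf =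
    finish (commit-walk p₁ exc₁ walk t (insert-here (V⁻ p) t) Dat at≢yf)
    where
    module S = Surplus s
    ¬B⁺ : ¬ B⁺ p t q
    ¬B⁺ B⁺tq = not-¬ (proj₁ (B⁺-inside p t q B⁺tq)) V⁺t
    p₁ : Pair
    p₁ = attach⁻ p t q (Q⊆V⁻ p q Qq) V⁻t Dtq ¬B⁺
    exc₁ : Excess p₁ y f
    exc₁ = Excess-attach⁻ (Q⊆V⁻ p q Qq) V⁻t Dtq ¬B⁺ (Surplus⇒Excess s)
    finish : Σ Pair (λ p′ → Committed p₁ p′ U t a) → Advance p
    finish (p′ , c) = (p′ , surplus⁻ surplus′) ,
      measure-<⁻ {p} {p′} t (V⁺-grows e) (λ v → V⁻-grows e v ∘ insert-⊇ (V⁻ p) t v) V⁻t t∈V⁻′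
      where
      e : Extends p₁ p′ U
      e = extends c
      t∈V⁻′ : V⁻ p′ t ≡ true
      t∈V⁻′ = V⁻-grows e t (insert-here (V⁻ p) t)
      V⁻⊆V⁺+t : V⁻ p′ ⊆ insert (V⁺ p′) t
      V⁻⊆V⁺+t v V⁻′v with V⁻-new e v V⁻′v
      ... | inj₂ V⁺′v = insert-⊇ (V⁺ p′) t v V⁺′v
      ... | inj₁ V⁻₁v with insert-⊆ (V⁻ p) t v V⁻₁v
      ...   | inj₁ refl = insert-here (V⁺ p′) t
      ...   | inj₂ V⁻v  = insert-⊇ (V⁺ p′) t v (V⁺-grows e v (S.V⁻⊆V⁺ v V⁻v))
      t∉V⁺′ : V⁺ p′ t ≡ false
      t∉V⁺′ = ¬-not λ V⁺′t → Sum.[ (λ V⁺t′ → not-¬ V⁺t′ V⁺t) , (λ Ut → not-¬ Ut t∉U) ] (V⁺-new e t V⁺′t)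
      B⁻-into-t : ∀ w → B⁻ p′ w t → w ≡ a
      B⁻-into-t w B⁻wt with B⁻-new c w t B⁻wt
      ... | inj₁ (inj₁ B⁻pwt)      = ⊥-elim (not-¬ (proj₂ (B⁻-inside p w t B⁻pwt)) V⁻t)
      ... | inj₁ (inj₂ (refl , _)) = ⊥-elim (not-¬ (Q⊆V⁻ p t Qq) V⁻t)
      ... | inj₂ (inj₁ (w≡a , _))  = w≡a
      ... | inj₂ (inj₂ Ut)         = ⊥-elim (not-¬ Ut t∉U)
      surplus′ : Surplus (reversePair p′) t a
      surplus′ = record
        { V⁻⊆V⁺ = V⁺⊆V⁻ c ; V⁺⊆V⁻+y = V⁻⊆V⁺+t ; y∈V⁺ = t∈V⁻′ ; y∉V⁻ = t∉V⁺′ ; B⁺-from-y = B⁻-into-t }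

  resolve : ∀ {p y f} → Surplus p y f → Advance p
  resolve s with find-exit s
  ... | record { walk = walk ; arc = Dat ; at≢yf = at≢yf ; lands = inj₁ V⁻t } =
    rebalance s walk V⁻t Dat at≢yf
  ... | record { walk = walk ; t∉U = t∉U ; arc = Dat ; at≢yf = at≢yf ; lands = inj₂ (V⁻t , V⁺t , nbr⁻) } =
    transfer-surplus s walk t∉U V⁻t V⁺t nbr⁻ Dat at≢yf

  begin-surplus : ∀ {p v} → Balanced p → V⁺ p v ≡ false → OutNbr D Q v → Advance p
  begin-surplus {p} {v} (V⁺⊆V⁻ , V⁻⊆V⁺) V⁺v (_ , q , Qq , Dqv) =
    (p′ , surplus⁺ s) , measure-<⁺ {p} {p′} v (insert-⊇ (V⁺ p) v) (⊆-refl) V⁺v (insert-here (V⁺ p) v)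
    where
    V⁻v : V⁻ p v ≡ false
    V⁻v = ⊆-∉ V⁻⊆V⁺ V⁺v
    ¬B⁻ : ¬ B⁻ p q v
    ¬B⁻ B⁻qv = not-¬ (proj₂ (B⁻-inside p q v B⁻qv)) V⁻v
    p′ : Pair
    p′ = attach⁺ p q v (Q⊆V⁺ p q Qq) V⁺v Dqv ¬B⁻
    -- v is a new leaf of B⁺, so the choice f = v is arbitrary.
    no-arc-from-v : ∀ w → B⁺ p′ v w → w ≡ v
    no-arc-from-v w (inj₁ B⁺vw)      = ⊥-elim (not-¬ (proj₁ (B⁺-inside p v w B⁺vw)) V⁺v)
    no-arc-from-v w (inj₂ (refl , _)) = ⊥-elim (not-¬ (Q⊆V⁺ p v Qq) V⁺v)
    s : Surplus p′ v v
    s = record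
      { V⁻⊆V⁺ = λ u → insert-⊇ (V⁺ p) v u ∘ V⁻⊆V⁺ u ; V⁺⊆V⁻+y = insert-mono v V⁺⊆V⁻
      ; y∈V⁺ = insert-here (V⁺ p) v ; y∉V⁻ = V⁻v ; B⁺-from-y = no-arc-from-v }

module _ {D : Digraph n} (conn : ArcConn≥2 D) {Q : VSet n} (cover : NbrCovered D Q) where

  private
    module A⁺ = Augmentation D conn Q cover
    module A⁻ = Augmentation (reverse D) (ArcConn≥2-reverse {D = D} conn) Q (NbrCovered-reverse {D = D} cover)

  advance : (s : Stage D Q) → HasGoodPair allV (Arc D) ⊎ Advance (proj₁ s)
  advance (p , balanced (V⁺⊆V⁻ , V⁻⊆V⁺)) with full-or-missing (V⁺ p)
  ... | inj₁ full = inj₁ (spanning⇒HasGoodPair p full (λ v → V⁺⊆V⁻ v (full v)))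
  ... | inj₂ (v , V⁺v) with cover v (⊆-∉ (Q⊆V⁺ p) V⁺v)
  ...   | inj₂ nbr⁺ = inj₂ (A⁺.begin-surplus {p} (V⁺⊆V⁻ , V⁻⊆V⁺) V⁺v nbr⁺)
  ...   | inj₁ nbr⁻ =
    inj₂ (Advance-reverse p (A⁻.begin-surplus {reversePair p} (V⁻⊆V⁺ , V⁺⊆V⁻) (⊆-∉ V⁻⊆V⁺ V⁺v) nbr⁻))
  advance (p , surplus⁺ s) = inj₂ (A⁺.resolve s)
  advance (p , surplus⁻ s) = inj₂ (Advance-reverse p (A⁻.resolve s))

corollary1 : {n : ℕ} (D : Digraph n) → ArcConn≥2 D →
    (VQ : VSet n) (AQ : ASet n) → IsSubdigraph D VQ AQ → HasGoodPair VQ AQ →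
    (∀ v → ¬ (InNbr D VQ v × OutNbr D VQ v)) →
    (∀ v → VQ v ≡ false → InNbr D VQ v ⊎ OutNbr D VQ v) →
    HasGoodPair allV (Arc D)
corollary1 D conn VQ AQ sub goodQ _ cover =
  ascend (measure ∘ proj₁) (measure≤ ∘ proj₁) (advance conn cover)
    (HasGoodPair⇒PartialGoodPair {D = D} sub goodQ , balanced ((⊆-refl) , (⊆-refl)))
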